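{- For every integer $n \geq 1$, \[ p(n) = \frac{1}{2}\left(1 + n + \sum_{\langle a_1,\dots,a_k\rangle \in \mathcal{A}(n)\setminus\{\langle n\rangle\}} \left\lfloor \frac{a_{k-1}+a_k}{a_{k-1}+1}\right\rfloor\right). \]
   Context: $p(n)$ denotes the number of partitions of $n$. An ascending composition of a positive integer $n$ is a sequence of positive integers $\langle a_1,\dots,a_k\rangle$ with $a_1+\dots+a_k=n$ and $a_1\le a_2\le\dots\le a_k$. $\mathcal{A}(n)$ is the set of all ascending compositions of $n$, and $\langle n\rangle$ is the one-part composition. Every element of $\mathcal{A}(n)\setminus\{\langle n\rangle\}$ has $k\ge 2$ parts, so $a_{k-1}$ is defined. -}

module Defs where

open import Data.Nat using (ℕ; zero; suc; _+_; _*_; _∸_; _≤_; _≤?_)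
open import Data.Nat.DivMod using (_/_)
open import Data.List using (List; []; _∷_; length; map; concatMap; upTo; filter)
open import Data.Nat.ListAction using (sum)
open import Relation.Nullary using (yes; no)

-- Ascending compositions of n (as lists a₁ ∷ … ∷ aₖ, a₁ ≤ … ≤ aₖ, all aᵢ ≥ 1)
-- whose parts are all ≥ m.
-- Fuel f ≥ n guarantees termination (each step removes a part ≥ 1).
ascFrom : ℕ → ℕ → ℕ → List (List ℕ)
ascFrom _       _ zero    = [] ∷ []
ascFrom zero    _ (suc _) = []
ascFrom (suc f) m (suc r) =
  concatMap (λ a → map (a ∷_) (ascFrom f a (suc r ∸ a)))
            (filter (λ a → m ≤? a) (map suc (upTo (suc r))))

𝒜 : ℕ → List (List ℕ)
𝒜 n = ascFrom n 1 n

data Ascending : List ℕ → Set where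
  []  : Ascending []
  [_] : ∀ a → Ascending (a ∷ [])
  _∷_ : ∀ {a b l} → a ≤ b → Ascending (b ∷ l) → Ascending (a ∷ b ∷ l)

-- p(n): the number of partitions of n, i.e. the number of ascending compositions.
p : ℕ → ℕ
p n = length (𝒜 n)

-- The summand ⌊(a_{k-1} + a_k)/(a_{k-1} + 1)⌋ for compositions with k ≥ 2 parts;
-- the one-part composition ⟨n⟩ (and the empty list) contribute 0, i.e. are excluded.
term : List ℕ → ℕ
term []              = 0
term (_ ∷ [])        = 0
term (x ∷ y ∷ [])    = (x + y) / suc x
term (_ ∷ y ∷ z ∷ l) = term (y ∷ z ∷ l)

S : ℕ → ℕ
S n = sum (map term (𝒜 n))

{-# OPTIONS --safe #-}
module Submission where

-- Write A(m, r) for the ascending compositions of r with all parts ≥ m, and T for the sum of the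
-- summands ⌊(a_{k-1} + a_k)/(a_{k-1} + 1)⌋ over a set of compositions.  Splitting off the first
-- part, A(m, r) is m prefixed to A(m, r − m), followed by A(m + 1, r).  Prefixing a part b to the
-- compositions of A(m, r) changes only the summand of the one-part composition ⟨r⟩, which gains
-- ⌊(b + r)/(b + 1)⌋.  Together with ⌊r/m⌋ = 1 + ⌊(r − m)/m⌋ this makes both sides of
-- 2 |A(m, r)| = T(A(m, r)) + 1 + ⌊r/m⌋   (1 ≤ m ≤ r)
-- change by the same amount when m decreases by one, so it follows by induction on r and downward
-- induction on m; m = 1 is the theorem.

open import Defs
open import Data.Nat using (ℕ; zero; suc; _+_; _*_; _∸_; _≤_; _<_; _≥_; _≤?_; _≤‴_; ≤‴-refl; ≤‴-step; NonZero; z≤n; s≤s; z<s)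
open import Data.Nat.Properties
open import Data.Nat.DivMod using (_/_; n/n≡1; n/1≡n; m/n≡1+[m∸n]/n; m≥n⇒m/n>0; m<n*o⇒m/o<n)
open import Data.Nat.ListAction using (sum)
open import Data.Nat.ListAction.Properties using (sum-++)
open import Data.Nat.Solver using (module +-*-Solver)
open +-*-Solver using (solve; _:+_; _:=_; con)
open import Data.List using (List; []; _∷_; _++_; length; map; concatMap; filter; upTo; applyUpTo)
open import Data.List.Properties
  using (map-++; map-∘; map-cong; length-++; length-map; map-concatMap; concatMap-cong; map-upTo; filter-accept; filter-reject)
open import Data.Empty using (⊥-elim)
open import Data.Sum using (inj₁; inj₂)
open import Function using (_∘_)
open import Relation.Nullary using (yes; no)
open import Relation.Binary.PropositionalEquality using (_≡_; refl; sym; trans; cong; cong₂; module ≡-Reasoning)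

range : ℕ → ℕ → List ℕ
range k zero    = []
range k (suc n) = k ∷ range (suc k) n

applyUpTo-range : ∀ {g : ℕ → ℕ} k n → (∀ i → g i ≡ k + i) → applyUpTo g n ≡ range k n
applyUpTo-range k zero    g≗k+ = refl
applyUpTo-range k (suc n) g≗k+ =
  cong₂ _∷_ (trans (g≗k+ 0) (+-identityʳ k))
            (applyUpTo-range (suc k) n (λ i → trans (g≗k+ (suc i)) (+-suc k i)))

map-suc-upTo : ∀ n → map suc (upTo n) ≡ range 1 n
map-suc-upTo n = trans (map-upTo suc n) (applyUpTo-range 1 n (λ _ → refl))

filter-≤-range-all : ∀ {m} k n → m ≤ k → filter (m ≤?_) (range k n) ≡ range k n
filter-≤-range-all     k zero    m≤k = refl
filter-≤-range-all {m} k (suc n) m≤k =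
  trans (filter-accept (m ≤?_) m≤k) (cong (k ∷_) (filter-≤-range-all (suc k) n (m≤n⇒m≤1+n m≤k)))

filter-≤-range-none : ∀ {m} k n → k + n ≤ m → filter (m ≤?_) (range k n) ≡ []
filter-≤-range-none     k zero    k+n≤m = refl
filter-≤-range-none {m} k (suc n) k+n≤m =
  trans (filter-reject (m ≤?_) (<⇒≱ (<-≤-trans (m<m+n k z<s) k+n≤m)))
        (filter-≤-range-none (suc k) n (≤-trans (≤-reflexive (sym (+-suc k n))) k+n≤m))

filter-≤-range-peel : ∀ {m} k n → k ≤ m → m < k + n →
                      filter (m ≤?_) (range k n) ≡ m ∷ filter (suc m ≤?_) (range k n)
filter-≤-range-peel k zero k≤m m<k+0 = ⊥-elim (<⇒≱ (<-≤-trans m<k+0 (≤-reflexive (+-identityʳ k))) k≤m)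
filter-≤-range-peel {m} k (suc n) k≤m m<k+n with m≤n⇒m<n∨m≡n k≤m
... | inj₂ refl =
  begin
    filter (m ≤?_) (m ∷ range (suc m) n)         ≡⟨ filter-accept (m ≤?_) ≤-refl ⟩
    m ∷ filter (m ≤?_) (range (suc m) n)         ≡⟨ cong (m ∷_) (filter-≤-range-all (suc m) n (n≤1+n m)) ⟩
    m ∷ range (suc m) n                          ≡⟨ cong (m ∷_) (filter-≤-range-all (suc m) n ≤-refl) ⟨
    m ∷ filter (suc m ≤?_) (range (suc m) n)     ≡⟨ cong (m ∷_) (filter-reject (suc m ≤?_) (n≮n m)) ⟨
    m ∷ filter (suc m ≤?_) (m ∷ range (suc m) n) ∎
  where open ≡-Reasoning
... | inj₁ k<m =
  begin
    filter (m ≤?_) (k ∷ range (suc k) n)         ≡⟨ filter-reject (m ≤?_) (<⇒≱ k<m) ⟩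
    filter (m ≤?_) (range (suc k) n)             ≡⟨ filter-≤-range-peel (suc k) n k<m m<1+k+n ⟩
    m ∷ filter (suc m ≤?_) (range (suc k) n)     ≡⟨ cong (m ∷_) (filter-reject (suc m ≤?_) (<⇒≱ (m<n⇒m<1+n k<m))) ⟨
    m ∷ filter (suc m ≤?_) (k ∷ range (suc k) n) ∎
  where
    open ≡-Reasoning
    m<1+k+n : m < suc k + n
    m<1+k+n = ≤-trans m<k+n (≤-reflexive (+-suc k n))

candidates-none : ∀ {m} n → n < m → filter (m ≤?_) (map suc (upTo n)) ≡ []
candidates-none n n<m rewrite map-suc-upTo n = filter-≤-range-none 1 n n<m

candidates-peel : ∀ {m} n → suc m ≤ n →
                  filter (suc m ≤?_) (map suc (upTo n)) ≡ suc m ∷ filter (suc (suc m) ≤?_) (map suc (upTo n))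
candidates-peel n m<n rewrite map-suc-upTo n = filter-≤-range-peel 1 n (s≤s z≤n) (s≤s m<n)

ascFrom-empty : ∀ f {m r} → 0 < r → r < m → ascFrom f m r ≡ []
ascFrom-empty zero    {r = suc r} _ _   = refl
ascFrom-empty (suc f) {r = suc r} _ r<m =
  cong (concatMap (λ a → map (a ∷_) (ascFrom f a (suc r ∸ a)))) (candidates-none (suc r) r<m)

ascFrom-peel : ∀ f {m r} → suc m ≤ r →
               ascFrom (suc f) (suc m) r ≡
               map (suc m ∷_) (ascFrom f (suc m) (r ∸ suc m)) ++ ascFrom (suc f) (suc (suc m)) r
ascFrom-peel f {r = suc r} m<r =
  cong (concatMap (λ a → map (a ∷_) (ascFrom f a (suc r ∸ a)))) (candidates-peel (suc r) m<r)

ascFrom-single : ∀ f m → ascFrom (suc f) (suc m) (suc m) ≡ (suc m ∷ []) ∷ []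
ascFrom-single f m
  rewrite ascFrom-peel f (≤-refl {suc m}) | n∸n≡0 m | ascFrom-empty (suc f) {suc (suc m)} z<s ≤-refl = refl

map-ascFrom-cong-∷ : ∀ {A : Set} {g h : List ℕ → A} f m {r} → 0 < r →
                     (∀ a l → g (a ∷ l) ≡ h (a ∷ l)) → map g (ascFrom f m r) ≡ map h (ascFrom f m r)
map-ascFrom-cong-∷ zero m {suc r} _ _ = refl
map-ascFrom-cong-∷ {g = g} {h} (suc f) m {suc r} _ g≗h =
  begin
    map g (concatMap block parts)    ≡⟨ map-concatMap g block parts ⟩
    concatMap (map g ∘ block) parts  ≡⟨ concatMap-cong agree parts ⟩
    concatMap (map h ∘ block) parts  ≡⟨ map-concatMap h block parts ⟨
    map h (concatMap block parts)    ∎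
  where
    open ≡-Reasoning
    block : ℕ → List (List ℕ)
    block a = map (a ∷_) (ascFrom f a (suc r ∸ a))
    parts : List ℕ
    parts = filter (m ≤?_) (map suc (upTo (suc r)))
    agree : ∀ a → map g (block a) ≡ map h (block a)
    agree a = trans (sym (map-∘ _)) (trans (map-cong (g≗h a) _) (map-∘ _))

termSum : List (List ℕ) → ℕ
termSum ls = sum (map term ls)

termSum-++ : ∀ ls ks → termSum (ls ++ ks) ≡ termSum ls + termSum ks
termSum-++ ls ks = trans (cong sum (map-++ term ls ks)) (sum-++ (map term ls) (map term ks))

termSum-∷-∷ : ∀ f b a m {s} → 0 < s →
              termSum (map (b ∷_) (map (a ∷_) (ascFrom f m s))) ≡ termSum (map (a ∷_) (ascFrom f m s))
termSum-∷-∷ f b a m {s} 0<s = cong sum (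
  begin
    map term (map (b ∷_) (map (a ∷_) X))  ≡⟨ map-∘ (map (a ∷_) X) ⟨
    map (term ∘ (b ∷_)) (map (a ∷_) X)    ≡⟨ map-∘ X ⟨
    map (λ l → term (b ∷ a ∷ l)) X        ≡⟨ map-ascFrom-cong-∷ f m 0<s (λ _ _ → refl) ⟩
    map (λ l → term (a ∷ l)) X            ≡⟨ map-∘ X ⟩
    map term (map (a ∷_) X)               ∎)
  where
    open ≡-Reasoning
    X : List (List ℕ)
    X = ascFrom f m s

termSum-map-∷ : ∀ f b {m r} → suc m ≤ r →
                termSum (map (b ∷_) (ascFrom (suc f) (suc m) r)) ≡ termSum (ascFrom (suc f) (suc m) r) + (b + r) / suc b
termSum-map-∷ f b {r = r} m<r = go (≤⇒≤‴ m<r)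
  where
    open ≡-Reasoning
    K : ℕ
    K = (b + r) / suc b
    go : ∀ {m} → suc m ≤‴ r →
         termSum (map (b ∷_) (ascFrom (suc f) (suc m) r)) ≡ termSum (ascFrom (suc f) (suc m) r) + K
    go {m} ≤‴-refl rewrite ascFrom-single f m = +-identityʳ K
    go {m} (≤‴-step 1+m<‴r) =
      begin
        termSum (map (b ∷_) (ascFrom (suc f) (suc m) r))  ≡⟨ cong (termSum ∘ map (b ∷_)) peel ⟩
        termSum (map (b ∷_) (B ++ A))                     ≡⟨ cong termSum (map-++ (b ∷_) B A) ⟩
        termSum (map (b ∷_) B ++ map (b ∷_) A)            ≡⟨ termSum-++ (map (b ∷_) B) (map (b ∷_) A) ⟩
        termSum (map (b ∷_) B) + termSum (map (b ∷_) A)   ≡⟨ cong₂ _+_ (termSum-∷-∷ f b (suc m) (suc m) 0<s) (go 1+m<‴r) ⟩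
        termSum B + (termSum A + K)                       ≡⟨ +-assoc (termSum B) (termSum A) K ⟨
        termSum B + termSum A + K                         ≡⟨ cong (_+ K) (termSum-++ B A) ⟨
        termSum (B ++ A) + K                              ≡⟨ cong (λ ls → termSum ls + K) peel ⟨
        termSum (ascFrom (suc f) (suc m) r) + K           ∎
      where
        1+m<r : suc m < r
        1+m<r = ≤‴⇒≤ 1+m<‴r
        0<s : 0 < r ∸ suc m
        0<s = m<n⇒0<n∸m 1+m<r
        B A : List (List ℕ)
        B = map (suc m ∷_) (ascFrom f (suc m) (r ∸ suc m))
        A = ascFrom (suc f) (suc (suc m)) r
        peel : ascFrom (suc f) (suc m) r ≡ B ++ A
        peel = ascFrom-peel f (<⇒≤ 1+m<r)

d≤n<d+d⇒n/d≡1 : ∀ {n d} .{{_ : NonZero d}} → d ≤ n → n < d + d → n / d ≡ 1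
d≤n<d+d⇒n/d≡1 {n} {d} d≤n n<d+d = ≤-antisym (<⇒≤pred (m<n*o⇒m/o<n n<2*d)) (m≥n⇒m/n>0 d≤n)
  where
    n<2*d : n < 2 * d
    n<2*d = <-≤-trans n<d+d (≤-reflexive (cong (d +_) (sym (+-identityʳ d))))

CountIdentity : ℕ → Set
CountIdentity f = ∀ {m r} → suc m ≤ r → r ≤ f →
                  2 * length (ascFrom f (suc m) r) ≡ termSum (ascFrom f (suc m) r) + 1 + r / suc m

leading-block-identity : ∀ f {m r} → CountIdentity f → suc m < r → r ≤ suc f →
  2 * length (map (suc m ∷_) (ascFrom f (suc m) (r ∸ suc m))) + r / suc (suc m) ≡
  termSum (map (suc m ∷_) (ascFrom f (suc m) (r ∸ suc m))) + r / suc m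
leading-block-identity zero _ (s≤s (s≤s _)) (s≤s ())
leading-block-identity (suc f) {m} {r} count 1+m<r r≤2+f with suc m ≤? r ∸ suc m
... | yes m<s =
  begin
    2 * length (map (suc m ∷_) X) + q₁ ≡⟨ cong (λ n → 2 * n + q₁) (length-map (suc m ∷_) X) ⟩
    2 * length X + q₁                  ≡⟨ cong (_+ q₁) (count m<s s≤1+f) ⟩
    termSum X + 1 + s / suc m + q₁     ≡⟨ solve 3 (λ t q q′ → t :+ con 1 :+ q :+ q′ := t :+ q′ :+ (con 1 :+ q)) refl
                                               (termSum X) (s / suc m) q₁ ⟩
    termSum X + q₁ + (1 + s / suc m)   ≡⟨ cong₂ _+_ prefix (m/n≡1+[m∸n]/n (<⇒≤ 1+m<r)) ⟨
    termSum (map (suc m ∷_) X) + r / suc m ∎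
  where
    open ≡-Reasoning
    q₁ = r / suc (suc m)
    s = r ∸ suc m
    X = ascFrom (suc f) (suc m) s
    s≤1+f : s ≤ suc f
    s≤1+f = ∸-mono r≤2+f (s≤s (z≤n {m}))
    prefix : termSum (map (suc m ∷_) X) ≡ termSum X + q₁
    prefix = trans (termSum-map-∷ f (suc m) m<s)
                   (cong (λ n → termSum X + n / suc (suc m)) (m+[n∸m]≡n (<⇒≤ 1+m<r)))
... | no m≮s rewrite ascFrom-empty (suc f) (m<n⇒0<n∸m 1+m<r) (≰⇒> m≮s) =
  trans (d≤n<d+d⇒n/d≡1 1+m<r (<-≤-trans r<2+2m (+-mono-≤ (n≤1+n (suc m)) (n≤1+n (suc m)))))
        (sym (d≤n<d+d⇒n/d≡1 (<⇒≤ 1+m<r) r<2+2m))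
  where
    r<2+2m : r < suc m + suc m
    r<2+2m = ≤-trans (s≤s (≤-reflexive (sym (m+[n∸m]≡n (<⇒≤ 1+m<r))))) (+-monoʳ-< (suc m) (≰⇒> m≮s))

count-identity : ∀ f → CountIdentity f
count-identity zero    {r = suc _} _ ()
count-identity (suc f) {r = r} m<r r≤1+f = go (≤⇒≤‴ m<r)
  where
    open ≡-Reasoning
    go : ∀ {m} → suc m ≤‴ r →
         2 * length (ascFrom (suc f) (suc m) r) ≡ termSum (ascFrom (suc f) (suc m) r) + 1 + r / suc m
    go {m} ≤‴-refl =
      begin
        2 * length (ascFrom (suc f) (suc m) (suc m))                  ≡⟨ cong (λ ls → 2 * length ls) single ⟩
        0 + 1 + 1                                                    ≡⟨ cong (0 + 1 +_) (n/n≡1 (suc m)) ⟨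
        0 + 1 + suc m / suc m                                        ≡⟨ cong (λ ls → termSum ls + 1 + suc m / suc m) single ⟨
        termSum (ascFrom (suc f) (suc m) (suc m)) + 1 + suc m / suc m ∎
      where
        single = ascFrom-single f m
    go {m} (≤‴-step 1+m<‴r) =
      begin
        2 * length (ascFrom (suc f) (suc m) r) ≡⟨ cong (λ ls → 2 * length ls) peel ⟩
        2 * length (B ++ A)                    ≡⟨ cong (2 *_) (length-++ B) ⟩
        2 * (length B + length A)              ≡⟨ *-distribˡ-+ 2 (length B) (length A) ⟩
        2 * length B + 2 * length A            ≡⟨ cong (2 * length B +_) (go 1+m<‴r) ⟩
        2 * length B + (termSum A + 1 + q₁)    ≡⟨ solve 3 (λ n t q → n :+ (t :+ con 1 :+ q) := n :+ q :+ (t :+ con 1)) refl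
                                                        (2 * length B) (termSum A) q₁ ⟩
        2 * length B + q₁ + (termSum A + 1)    ≡⟨ cong (_+ (termSum A + 1)) block ⟩
        termSum B + q₀ + (termSum A + 1)       ≡⟨ solve 3 (λ t t′ q → t :+ q :+ (t′ :+ con 1) := t :+ t′ :+ con 1 :+ q) refl
                                                        (termSum B) (termSum A) q₀ ⟩
        termSum B + termSum A + 1 + q₀         ≡⟨ cong (λ n → n + 1 + q₀) (termSum-++ B A) ⟨
        termSum (B ++ A) + 1 + q₀              ≡⟨ cong (λ ls → termSum ls + 1 + q₀) peel ⟨
        termSum (ascFrom (suc f) (suc m) r) + 1 + q₀ ∎
      where
        q₀ q₁ : ℕ
        q₀ = r / suc m
        q₁ = r / suc (suc m)
        B A : List (List ℕ)
        B = map (suc m ∷_) (ascFrom f (suc m) (r ∸ suc m))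
        A = ascFrom (suc f) (suc (suc m)) r
        peel : ascFrom (suc f) (suc m) r ≡ B ++ A
        peel = ascFrom-peel f (<⇒≤ (≤‴⇒≤ 1+m<‴r))
        block : 2 * length B + q₁ ≡ termSum B + q₀
        block = leading-block-identity f (count-identity f) (≤‴⇒≤ 1+m<‴r) r≤1+f

theorem3p13 : (n : ℕ) → n ≥ 1 → 2 * p n ≡ 1 + n + S n
theorem3p13 zero    ()
theorem3p13 (suc n) _ =
  begin
    2 * p (suc n)             ≡⟨ count-identity (suc n) (s≤s z≤n) ≤-refl ⟩
    S (suc n) + 1 + suc n / 1 ≡⟨ cong (S (suc n) + 1 +_) (n/1≡n (suc n)) ⟩
    S (suc n) + 1 + suc n     ≡⟨ +-assoc (S (suc n)) 1 (suc n) ⟩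
    S (suc n) + (1 + suc n)   ≡⟨ +-comm (S (suc n)) (1 + suc n) ⟩
    1 + suc n + S (suc n)     ∎
  where open ≡-Reasoning
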